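{- Let $G=(V,E)$ be an undirected graph that admits a nowhere-zero circular $k$-flow for some rational number $k\ge 2$, and let $\tau$ be a positive integer. Then for every nowhere-zero $\tau$-SCD $w$ of $\vec G$ there exist nonnegative integer vectors $x,y\in\mathbb{Z}^{E^+\cup E^- }_{\ge0}$ with $x+y\le w$ such that $x(\delta^+_{\vec G}(U))\ge\lfloor\tau/(k+1)\rfloor$ and $y(\delta^+_{\vec G}(U))\ge\lfloor\tau/(k+1)\rfloor$ for every $\emptyset\ne U\subsetneq V$ (i.e. $w$ packs two $\lfloor\tau/(k+1)\rfloor$-SCD's).
   Context: $\vec G=(V,E^+\cup E^-)$ is obtained from $G$ by replacing each edge $e=\{u,v\}$ by two arcs $e^+=(u,v)$ and $e^-=(v,u)$; $\delta^+_{\vec G}(U)$ is the set of arcs of $\vec G$ leaving $U$ and $x(F)=\sum_{a\in F}x_a$. A nowhere-zero $\tau$-SCD of $\vec G$ is an integer vector $w\in\mathbb{Z}^{E^+\cup E^- }$ with $w_a\ge 1$ for every arc $a$ and $w(\delta^+_{\vec G}(U))\ge\tau$ for every $\emptyset\ne U\subsetneq V$. A nowhere-zero circular $k$-flow of $G$ is an orientation $E^+$ of $E$ and a function $f:E^+\to[1,k-1]$ with flow conservation $\sum_{e\in\delta^+_{E^+}(v)}f(e)=\sum_{e\in\delta^-_{E^+}(v)}f(e)$ at every vertex $v$.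
   Formalization: The nowhere-zero circular k-flow whose existence is assumed must take only rational values in [1,k−1]. -}

module Defs where

open import Data.Nat using (ℕ; suc)
open import Data.Bool using (Bool; true; false; if_then_else_)
open import Data.Fin using (Fin)
open import Data.Fin.Properties using (_≟_)
open import Data.List using (List; []; _∷_; map; allFin; foldr; concatMap)
open import Data.Product using (Σ; ∃; _×_; _,_; proj₁; proj₂)
open import Data.Integer as ℤ using (ℤ; +_)
open import Data.Rational as ℚ using (ℚ; 0ℚ; 1ℚ; floor)
import Data.Rational.Properties as ℚP
open import Relation.Nullary using (¬_; yes; no; does)
open import Relation.Binary.PropositionalEquality using (_≡_)

record Graph : Set where
  field
    n    : ℕ
    m    : ℕ
    ends : Fin m → Fin n × Fin n
open Graph public

-- Arcs of the bidirected graph G⃗ : (e , true) is e⁺ = (u,v),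
-- (e , false) is e⁻ = (v,u).
Arc : Graph → Set
Arc G = Fin (m G) × Bool

tail head : (G : Graph) → Arc G → Fin (n G)
tail G (e , true)  = proj₁ (ends G e)
tail G (e , false) = proj₂ (ends G e)
head G (e , true)  = proj₂ (ends G e)
head G (e , false) = proj₁ (ends G e)

allArcs : (G : Graph) → List (Arc G)
allArcs G = concatMap (λ e → (e , true) ∷ (e , false) ∷ []) (allFin (m G))

VSubset : Graph → Set
VSubset G = Fin (n G) → Bool

NonTrivialCut : (G : Graph) → VSubset G → Set
NonTrivialCut G U = (∃ λ v → U v ≡ true) × (∃ λ v → U v ≡ false)

sumℤ : List ℤ → ℤ
sumℤ = foldr ℤ._+_ (+ 0)

outSum : (G : Graph) → (Arc G → ℤ) → VSubset G → ℤ
outSum G x U =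
  sumℤ (map (λ a → if U (tail G a) then (if U (head G a) then + 0 else x a) else + 0)
            (allArcs G))

IsSCD : (G : Graph) → ℤ → (Arc G → ℤ) → Set
IsSCD G τ w = ∀ (U : VSubset G) → NonTrivialCut G U → τ ℤ.≤ outSum G w U

IsNowhereZeroSCD : (G : Graph) → ℤ → (Arc G → ℤ) → Set
IsNowhereZeroSCD G τ w = (∀ a → + 1 ℤ.≤ w a) × IsSCD G τ w

-- Nowhere-zero circular k-flow: an orientation o of E (o e = true means
-- e is oriented as (u,v), false as (v,u)) and f : E → [1, k-1] with
-- flow conservation at every vertex.
sumℚ : List ℚ → ℚ
sumℚ = foldr ℚ._+_ 0ℚ

orientedTail orientedHead : (G : Graph) → (Fin (m G) → Bool) → Fin (m G) → Fin (n G)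
orientedTail G o e = tail G (e , o e)
orientedHead G o e = head G (e , o e)

outFlow inFlow : (G : Graph) → (Fin (m G) → Bool) → (Fin (m G) → ℚ) → Fin (n G) → ℚ
outFlow G o f v =
  sumℚ (map (λ e → if does (orientedTail G o e ≟ v) then f e else 0ℚ) (allFin (m G)))
inFlow G o f v =
  sumℚ (map (λ e → if does (orientedHead G o e ≟ v) then f e else 0ℚ) (allFin (m G)))

HasNowhereZeroCircularFlow : Graph → ℚ → Set
HasNowhereZeroCircularFlow G k =
  Σ (Fin (m G) → Bool) λ o → Σ (Fin (m G) → ℚ) λ f →
    (∀ e → (1ℚ ℚ.≤ f e) × (f e ℚ.≤ k ℚ.- 1ℚ)) ×
    (∀ v → outFlow G o f v ≡ inFlow G o f v)

-- 1/q, with the (irrelevant) convention 1/0 = 0 so it is total; only used for q = k+1 ≥ 3.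
recip : ℚ → ℚ
recip q with q ℚP.≟ 0ℚ
... | yes _  = 0ℚ
... | no q≢0 = ℚ.1/_ q {{ℚ.≢-nonZero q≢0}}

floorDiv : ℤ → ℚ → ℤ
floorDiv τ k = floor ((τ ℚ./ 1) ℚ.* recip (k ℚ.+ 1ℚ))

module Submission where

-- Orient G by the circular flow f, so that 1 ≤ f ≤ k − 1 on every edge, and split the weight of each
-- arc into halves: x takes ⌈w/2⌉ on the arcs running along the orientation and ⌊w/2⌋ on those
-- running against it, y does the same for the reversed orientation, so x + y = w.  If φ = ±f is the
-- flow carried by an arc (negative against the orientation), then w + φ ≤ (k + 1)·x on every arc:
-- along it because w ≤ 2⌈w/2⌉ and f ≤ (k − 1)⌈w/2⌉, against it because w − f ≤ w − 1 ≤ 2⌊w/2⌋.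
-- Summed over the arcs leaving U, the φ add up to the net flow out of U, which is 0 by conservation,
-- so τ ≤ w(δ⁺U) ≤ (k + 1)·x(δ⁺U), i.e. ⌊τ/(k + 1)⌋ ≤ x(δ⁺U).  The reversed flow is again a
-- circulation, which gives the same bound for y.

module FiniteSums where
  open import Defs
  open import Algebra.Bundles using (Ring)
  import Data.Rational.Properties as ℚP
  open import Algebra.Properties.Semiring.Sum (Ring.semiring ℚP.+-*-ring)
    using (sum; sum-syntax; sum-cong-≗; sum-replicate-zero; ∑-comm)
  open import Data.Bool using (Bool; true; false; if_then_else_)
  open import Data.Bool.Properties using (if-swap-then)
  open import Data.Fin using (Fin; zero; suc)
  open import Data.Fin.Properties using (_≟_)
  open import Data.List using (map; allFin; tabulate)
  open import Data.List.Properties using (map-tabulate)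
  open import Data.Nat using (zero; suc)
  open import Data.Rational using (ℚ; 0ℚ; _+_; _-_; _≤_)
  open import Data.Rational.Solver using (module +-*-Solver)
  open import Function using (_∘_; id)
  open import Relation.Nullary using (does)
  open import Relation.Binary.PropositionalEquality using (_≡_; refl; sym; trans; cong; module ≡-Reasoning)

  sumℚ-tabulate : ∀ {n} (F : Fin n → ℚ) → sumℚ (tabulate F) ≡ sum F
  sumℚ-tabulate {zero}  F = refl
  sumℚ-tabulate {suc n} F = cong (F zero +_) (sumℚ-tabulate (F ∘ suc))

  sumℚ-allFin : ∀ {n} (F : Fin n → ℚ) → sumℚ (map F (allFin n)) ≡ sum F
  sumℚ-allFin F = trans (cong sumℚ (map-tabulate id F)) (sumℚ-tabulate F)

  ∑-mono-≤ : ∀ {n} {F G : Fin n → ℚ} → (∀ i → F i ≤ G i) → sum F ≤ sum G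
  ∑-mono-≤ {zero}  _   = ℚP.≤-refl
  ∑-mono-≤ {suc n} F≤G = ℚP.+-mono-≤ (F≤G zero) (∑-mono-≤ (F≤G ∘ suc))

  ∑-distrib-- : ∀ {n} (F G : Fin n → ℚ) → ∑[ i < n ] (F i - G i) ≡ sum F - sum G
  ∑-distrib-- {zero}  F G = refl
  ∑-distrib-- {suc n} F G = trans (cong (F zero - G zero +_) (∑-distrib-- (F ∘ suc) (G ∘ suc)))
    (solve 4 (λ a b c d → (a :- b) :+ (c :- d) := (a :+ c) :- (b :+ d)) refl
      (F zero) (G zero) (sum (F ∘ suc)) (sum (G ∘ suc)))
    where open +-*-Solver

  ∑-select : ∀ {n} (t : Fin n) (g : Fin n → ℚ) → ∑[ v < n ] (if does (t ≟ v) then g v else 0ℚ) ≡ g t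
  ∑-select {suc n} zero    g = trans (cong (g zero +_) (sum-replicate-zero n)) (ℚP.+-identityʳ (g zero))
  ∑-select {suc n} (suc t) g = trans (ℚP.+-identityˡ _) (∑-select t (g ∘ suc))

  if-∑ : ∀ {n} b (F : Fin n → ℚ) → (if b then sum F else 0ℚ) ≡ ∑[ i < n ] (if b then F i else 0ℚ)
  if-∑     true  F = refl
  if-∑ {n} false F = sym (sum-replicate-zero n)

  ∑-fibres : ∀ {m n} (t : Fin m → Fin n) (F : Fin m → ℚ) (U : Fin n → Bool) →
    ∑[ v < n ] (if U v then sumℚ (map (λ e → if does (t e ≟ v) then F e else 0ℚ) (allFin m)) else 0ℚ)
      ≡ ∑[ e < m ] (if U (t e) then F e else 0ℚ)
  ∑-fibres {m} {n} t F U = begin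
    ∑[ v < n ] (if U v then sumℚ (map (δ v) (allFin m)) else 0ℚ)
      ≡⟨ sum-cong-≗ (λ v → cong (λ s → if U v then s else 0ℚ) (sumℚ-allFin (δ v))) ⟩
    ∑[ v < n ] (if U v then sum (δ v) else 0ℚ)
      ≡⟨ sum-cong-≗ (λ v → if-∑ (U v) (δ v)) ⟩
    ∑[ v < n ] ∑[ e < m ] (if U v then δ v e else 0ℚ)
      ≡⟨ ∑-comm (λ v e → if U v then δ v e else 0ℚ) ⟩
    ∑[ e < m ] ∑[ v < n ] (if U v then δ v e else 0ℚ)
      ≡⟨ sum-cong-≗ (λ e → trans (sum-cong-≗ (λ v → if-swap-then (U v) (does (t e ≟ v))))
                                  (∑-select (t e) (λ v → if U v then F e else 0ℚ))) ⟩
    ∑[ e < m ] (if U (t e) then F e else 0ℚ) ∎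
    where
    open ≡-Reasoning
    δ : Fin n → Fin m → ℚ
    δ v e = if does (t e ≟ v) then F e else 0ℚ

module FromInteger where
  open import Defs
  open import Data.List using ([]; _∷_; map)
  open import Data.Nat using (suc)
  open import Data.Integer as ℤ using (ℤ; +_)
  import Data.Integer.Properties as ℤP
  open import Data.Integer.DivMod using ([n/d]*d≤n)
  import Data.Integer.Solver as ℤSolver
  open import Data.Rational
    using (ℚ; mkℚ; 0ℚ; 1ℚ; _/_; _+_; _*_; _≤_; _<_; *≤*; floor; 1/_; NonZero; NonNegative; ≢-nonZero; positive)
  open import Data.Rational.Literals using (fromℤ)
  import Data.Rational.Properties as ℚP
  import Data.Rational.Unnormalised as ℚᵘ
  import Data.Rational.Unnormalised.Properties as ℚᵘP
  import Data.Rational.Solver as ℚSolver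
  open import Data.Empty using (⊥-elim)
  open import Function using (_∘_)
  open import Relation.Nullary using (yes; no)
  open import Relation.Binary.PropositionalEquality using (_≡_; refl; sym; trans; cong; subst)

  fromℤ-homo-+ : ∀ a b → fromℤ (a ℤ.+ b) ≡ fromℤ a + fromℤ b
  fromℤ-homo-+ a b = ℚP.toℚᵘ-injective
    (ℚᵘP.≃-trans (ℚᵘ.*≡* cross-multiplied) (ℚᵘP.≃-sym (ℚP.toℚᵘ-homo-+ (fromℤ a) (fromℤ b))))
    where
    open ℤSolver.+-*-Solver
    cross-multiplied : (a ℤ.+ b) ℤ.* + 1 ≡ (a ℤ.* + 1 ℤ.+ b ℤ.* + 1) ℤ.* + 1
    cross-multiplied = solve 2 (λ a b → (a :+ b) :* con (+ 1) := (a :* con (+ 1) :+ b :* con (+ 1)) :* con (+ 1)) refl a b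

  fromℤ-mono-≤ : ∀ {a b} → a ℤ.≤ b → fromℤ a ≤ fromℤ b
  fromℤ-mono-≤ a≤b = *≤* (ℤP.*-monoʳ-≤-nonNeg (+ 1) a≤b)

  fromℤ-sumℤ : ∀ {A : Set} (g : A → ℤ) l → fromℤ (sumℤ (map g l)) ≡ sumℚ (map (fromℤ ∘ g) l)
  fromℤ-sumℤ g []      = refl
  fromℤ-sumℤ g (x ∷ l) = trans (fromℤ-homo-+ (g x) _) (cong (_+_ (fromℤ (g x))) (fromℤ-sumℤ g l))

  /1≡fromℤ : ∀ z → z / 1 ≡ fromℤ z
  /1≡fromℤ z = ℚP.fromℚᵘ-toℚᵘ (fromℤ z)

  q≤z⇒⌊q⌋≤z : ∀ q z → q ≤ fromℤ z → floor q ℤ.≤ z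
  q≤z⇒⌊q⌋≤z q@(mkℚ a d _) z (*≤* a*1≤z*d) = ℤP.*-cancelʳ-≤-pos (floor q) z (+ suc d) (begin
    floor q ℤ.* + suc d  ≤⟨ [n/d]*d≤n a (+ suc d) ⟩
    a                    ≡⟨ ℤP.*-identityʳ a ⟨
    a ℤ.* + 1            ≤⟨ a*1≤z*d ⟩
    z ℤ.* + suc d        ∎)
    where open ℤP.≤-Reasoning

  a≤pb⇒a/p≤b : ∀ {a b p} → 0ℚ < p → a ≤ p * b → a * recip p ≤ b
  a≤pb⇒a/p≤b {a} {b} {p} p>0 a≤pb with p ℚP.≟ 0ℚ
  ... | yes p≡0 = ⊥-elim (ℚP.<-irrefl (sym p≡0) p>0)
  ... | no  p≢0 = begin
    a * p⁻¹      ≤⟨ ℚP.*-monoʳ-≤-nonNeg p⁻¹ a≤pb ⟩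
    p * b * p⁻¹  ≡⟨ solve 3 (λ p b q → p :* b :* q := (p :* q) :* b) refl p b p⁻¹ ⟩
    p * p⁻¹ * b  ≡⟨ cong (_* b) (ℚP.*-inverseʳ p) ⟩
    1ℚ * b       ≡⟨ ℚP.*-identityˡ b ⟩
    b            ∎
    where
    open ℚP.≤-Reasoning
    open ℚSolver.+-*-Solver
    instance
      p≢0′ : NonZero p
      p≢0′ = ≢-nonZero p≢0
    p⁻¹ : ℚ
    p⁻¹ = 1/ p
    instance
      p⁻¹≥0 : NonNegative p⁻¹
      p⁻¹≥0 = ℚP.pos⇒nonNeg p⁻¹ {{ℚP.1/pos⇒pos p {{positive p>0}}}}

  k+1>0 : ∀ {k} → + 2 / 1 ≤ k → 0ℚ < k + 1ℚ
  k+1>0 {k} k≥2 = begin-strict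
    0ℚ       <⟨ ℚP.positive⁻¹ 1ℚ ⟩
    1ℚ       ≡⟨ ℚP.+-identityˡ 1ℚ ⟨
    0ℚ + 1ℚ  ≤⟨ ℚP.+-monoˡ-≤ 1ℚ (ℚP.≤-trans (ℚP.nonNegative⁻¹ (+ 2 / 1)) k≥2) ⟩
    k + 1ℚ   ∎
    where open ℚP.≤-Reasoning

  floorDiv-≤ : ∀ {τ k s} → 0ℚ < k + 1ℚ → fromℤ τ ≤ (k + 1ℚ) * fromℤ s → floorDiv τ k ℤ.≤ s
  floorDiv-≤ {τ} {k} {s} k+1>0 τ≤[k+1]s = q≤z⇒⌊q⌋≤z _ s
    (subst (λ t → t * recip (k + 1ℚ) ≤ fromℤ s) (sym (/1≡fromℤ τ)) (a≤pb⇒a/p≤b k+1>0 τ≤[k+1]s))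

module Halving where
  open FromInteger
  open import Data.Bool using (Bool; true; false; not; if_then_else_)
  open import Data.Nat as ℕ using (ℕ; suc; ⌊_/2⌋; ⌈_/2⌉)
  import Data.Nat.Properties as ℕP
  open import Data.Integer as ℤ using (+_)
  open import Data.Rational using (ℚ; 0ℚ; 1ℚ; _+_; _-_; -_; _*_; _≤_; nonNegative)
  open import Data.Rational.Literals using (fromℤ)
  import Data.Rational.Properties as ℚP
  open import Data.Rational.Solver using (module +-*-Solver)
  open import Relation.Binary.PropositionalEquality using (_≡_; refl; sym; trans; cong)

  half : Bool → ℕ → ℕ
  half false n = ⌈ n /2⌉
  half true  n = ⌊ n /2⌋

  half-complement : ∀ d n → half d n ℕ.+ half (not d) n ≡ n
  half-complement false n = trans (ℕP.+-comm ⌈ n /2⌉ ⌊ n /2⌋) (ℕP.⌊n/2⌋+⌈n/2⌉≡n n)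
  half-complement true  n = ℕP.⌊n/2⌋+⌈n/2⌉≡n n

  n≤⌈n/2⌉+⌈n/2⌉ : ∀ n → n ℕ.≤ ⌈ n /2⌉ ℕ.+ ⌈ n /2⌉
  n≤⌈n/2⌉+⌈n/2⌉ n = ℕP.≤-trans (ℕP.≤-reflexive (sym (ℕP.⌊n/2⌋+⌈n/2⌉≡n n)))
    (ℕP.+-monoˡ-≤ ⌈ n /2⌉ (ℕP.⌊n/2⌋≤⌈n/2⌉ n))

  n≤1+⌊n/2⌋+⌊n/2⌋ : ∀ n → n ℕ.≤ suc (⌊ n /2⌋ ℕ.+ ⌊ n /2⌋)
  n≤1+⌊n/2⌋+⌊n/2⌋ n = ℕP.≤-trans (ℕP.≤-reflexive (sym (ℕP.⌊n/2⌋+⌈n/2⌉≡n n)))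
    (ℕP.≤-trans (ℕP.+-monoʳ-≤ ⌊ n /2⌋ (ℕP.⌊n/2⌋-mono (ℕP.n≤1+n (suc n))))
                (ℕP.≤-reflexive (ℕP.+-suc ⌊ n /2⌋ ⌊ n /2⌋)))

  module _ {k : ℚ} where
    open +-*-Solver

    k+1-split : ∀ c → (k + 1ℚ) * c ≡ (c + c) + (k - 1ℚ) * c
    k+1-split = solve 2 (λ k c → (k :+ con 1ℚ) :* c := (c :+ c) :+ (k :- con 1ℚ) :* c) refl k

    k-1≥0 : ∀ {f} → 1ℚ ≤ f → f ≤ k - 1ℚ → 0ℚ ≤ k - 1ℚ
    k-1≥0 f≥1 f≤k-1 = ℚP.≤-trans (ℚP.≤-trans (ℚP.nonNegative⁻¹ 1ℚ) f≥1) f≤k-1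

    along-bound : ∀ {w c f} → 0ℚ ≤ k - 1ℚ → 1ℚ ≤ c → w ≤ c + c → f ≤ k - 1ℚ → w + f ≤ (k + 1ℚ) * c
    along-bound {w} {c} {f} k-1≥0 c≥1 w≤2c f≤k-1 = begin
      w + f                   ≤⟨ ℚP.+-mono-≤ w≤2c f≤[k-1]c ⟩
      (c + c) + (k - 1ℚ) * c  ≡⟨ k+1-split c ⟨
      (k + 1ℚ) * c            ∎
      where
      open ℚP.≤-Reasoning
      instance _ = nonNegative k-1≥0
      f≤[k-1]c : f ≤ (k - 1ℚ) * c
      f≤[k-1]c = begin
        f              ≤⟨ f≤k-1 ⟩
        k - 1ℚ         ≡⟨ ℚP.*-identityʳ (k - 1ℚ) ⟨
        (k - 1ℚ) * 1ℚ  ≤⟨ ℚP.*-monoˡ-≤-nonNeg (k - 1ℚ) c≥1 ⟩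
        (k - 1ℚ) * c   ∎

    against-bound : ∀ {w d f} → 0ℚ ≤ k - 1ℚ → 0ℚ ≤ d → w ≤ 1ℚ + (d + d) → 1ℚ ≤ f → w - f ≤ (k + 1ℚ) * d
    against-bound {w} {d} {f} k-1≥0 d≥0 w≤1+2d f≥1 = begin
      w - f                   ≤⟨ ℚP.+-mono-≤ w≤1+2d (ℚP.neg-antimono-≤ f≥1) ⟩
      (1ℚ + (d + d)) - 1ℚ     ≡⟨ solve 1 (λ d → (con 1ℚ :+ (d :+ d)) :- con 1ℚ := (d :+ d) :+ con 0ℚ) refl d ⟩
      (d + d) + 0ℚ            ≤⟨ ℚP.+-monoʳ-≤ (d + d) [k-1]d≥0 ⟩
      (d + d) + (k - 1ℚ) * d  ≡⟨ k+1-split d ⟨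
      (k + 1ℚ) * d            ∎
      where
      open ℚP.≤-Reasoning
      instance _ = nonNegative k-1≥0
      [k-1]d≥0 : 0ℚ ≤ (k - 1ℚ) * d
      [k-1]d≥0 = ℚP.≤-trans (ℚP.≤-reflexive (sym (ℚP.*-zeroʳ (k - 1ℚ)))) (ℚP.*-monoˡ-≤-nonNeg (k - 1ℚ) d≥0)

    half-bound : ∀ {f} → 1ℚ ≤ f → f ≤ k - 1ℚ → ∀ d {w} → + 1 ℤ.≤ w →
      fromℤ w + (if d then - f else f) ≤ (k + 1ℚ) * fromℤ (+ half d ℤ.∣ w ∣)
    half-bound f≥1 f≤k-1 false (ℤ.+≤+ {n = n} n≥1) = along-bound (k-1≥0 f≥1 f≤k-1) ⌈n/2⌉≥1 n≤2⌈n/2⌉ f≤k-1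
      where
      ⌈n/2⌉≥1 : 1ℚ ≤ fromℤ (+ ⌈ n /2⌉)
      ⌈n/2⌉≥1 = fromℤ-mono-≤ (ℤ.+≤+ (ℕP.⌈n/2⌉-mono n≥1))
      n≤2⌈n/2⌉ : fromℤ (+ n) ≤ fromℤ (+ ⌈ n /2⌉) + fromℤ (+ ⌈ n /2⌉)
      n≤2⌈n/2⌉ = ℚP.≤-trans (fromℤ-mono-≤ (ℤ.+≤+ (n≤⌈n/2⌉+⌈n/2⌉ n)))
        (ℚP.≤-reflexive (fromℤ-homo-+ (+ ⌈ n /2⌉) (+ ⌈ n /2⌉)))
    half-bound f≥1 f≤k-1 true (ℤ.+≤+ {n = n} _) = against-bound (k-1≥0 f≥1 f≤k-1) ⌊n/2⌋≥0 n≤1+2⌊n/2⌋ f≥1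
      where
      ⌊n/2⌋≥0 : 0ℚ ≤ fromℤ (+ ⌊ n /2⌋)
      ⌊n/2⌋≥0 = fromℤ-mono-≤ (ℤ.+≤+ ℕ.z≤n)
      n≤1+2⌊n/2⌋ : fromℤ (+ n) ≤ 1ℚ + (fromℤ (+ ⌊ n /2⌋) + fromℤ (+ ⌊ n /2⌋))
      n≤1+2⌊n/2⌋ = ℚP.≤-trans (fromℤ-mono-≤ (ℤ.+≤+ (n≤1+⌊n/2⌋+⌊n/2⌋ n)))
        (ℚP.≤-reflexive (trans (fromℤ-homo-+ (+ 1) (+ (⌊ n /2⌋ ℕ.+ ⌊ n /2⌋)))
                               (cong (_+_ 1ℚ) (fromℤ-homo-+ (+ ⌊ n /2⌋) (+ ⌊ n /2⌋)))))

module CutSums where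
  open FiniteSums
  open FromInteger
  open import Defs
  open import Algebra.Bundles using (Ring)
  import Data.Rational.Properties as ℚP
  open import Algebra.Properties.Semiring.Sum (Ring.semiring ℚP.+-*-ring)
    using (sum-syntax; sum-cong-≗; ∑-distrib-+; *-distribˡ-sum)
  open import Algebra.Properties.CommutativeSemigroup (Ring.+-commutativeSemigroup ℚP.+-*-ring)
    using (interchange)
  open import Data.Bool using (Bool; true; false; if_then_else_)
  open import Data.Bool.Properties using (if-float)
  open import Data.List using ([]; _∷_; map; allFin; concatMap)
  open import Data.Product using (_,_)
  open import Data.Integer using (ℤ; +_)
  open import Data.Rational using (ℚ; 0ℚ; _+_; _*_; _≤_)
  open import Data.Rational.Literals using (fromℤ)
  open import Function using (_∘_)
  open import Relation.Binary.PropositionalEquality using (_≡_; refl; sym; trans; cong; cong₂)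

  ∑ᵃ : (G : Graph) → (Arc G → ℚ) → ℚ
  ∑ᵃ G F = ∑[ e < m G ] (F (e , true) + F (e , false))

  sumℚ-allArcs : ∀ G (F : Arc G → ℚ) → sumℚ (map F (allArcs G)) ≡ ∑ᵃ G F
  sumℚ-allArcs G F = trans (by-edges (allFin (m G))) (sumℚ-allFin (λ e → F (e , true) + F (e , false)))
    where
    by-edges : ∀ l → sumℚ (map F (concatMap (λ e → (e , true) ∷ (e , false) ∷ []) l))
                   ≡ sumℚ (map (λ e → F (e , true) + F (e , false)) l)
    by-edges []      = refl
    by-edges (e ∷ l) = trans (cong (λ s → F (e , true) + (F (e , false) + s)) (by-edges l))
                             (sym (ℚP.+-assoc (F (e , true)) (F (e , false)) _))

  ∑ᵃ-distrib-+ : ∀ G (F H : Arc G → ℚ) → ∑ᵃ G (λ a → F a + H a) ≡ ∑ᵃ G F + ∑ᵃ G H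
  ∑ᵃ-distrib-+ G F H = trans
    (sum-cong-≗ (λ e → interchange (F (e , true)) (H (e , true)) (F (e , false)) (H (e , false))))
    (∑-distrib-+ (λ e → F (e , true) + F (e , false)) (λ e → H (e , true) + H (e , false)))

  ∑ᵃ-mono-≤ : ∀ G {F H : Arc G → ℚ} → (∀ a → F a ≤ H a) → ∑ᵃ G F ≤ ∑ᵃ G H
  ∑ᵃ-mono-≤ G F≤H = ∑-mono-≤ (λ e → ℚP.+-mono-≤ (F≤H (e , true)) (F≤H (e , false)))

  *-distribˡ-∑ᵃ : ∀ G c (F : Arc G → ℚ) → c * ∑ᵃ G F ≡ ∑ᵃ G (λ a → c * F a)
  *-distribˡ-∑ᵃ G c F = trans (*-distribˡ-sum c (λ e → F (e , true) + F (e , false)))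
    (sum-cong-≗ (λ e → ℚP.*-distribˡ-+ c (F (e , true)) (F (e , false))))

  exiting : Bool → Bool → ℚ → ℚ
  exiting u v q = if u then (if v then 0ℚ else q) else 0ℚ

  exiting-+-≤ : ∀ u v c {p q r} → p + q ≤ c * r → exiting u v p + exiting u v q ≤ c * exiting u v r
  exiting-+-≤ true  false c p+q≤cr = p+q≤cr
  exiting-+-≤ true  true  c _      = ℚP.≤-reflexive (sym (ℚP.*-zeroʳ c))
  exiting-+-≤ false _     c _      = ℚP.≤-reflexive (sym (ℚP.*-zeroʳ c))

  onCut : (G : Graph) → VSubset G → Arc G → ℚ → ℚ
  onCut G U a = exiting (U (tail G a)) (U (head G a))

  cutSum : (G : Graph) → VSubset G → (Arc G → ℚ) → ℚ
  cutSum G U q = ∑ᵃ G (λ a → onCut G U a (q a))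

  fromℤ-outSum : ∀ G (z : Arc G → ℤ) U → fromℤ (outSum G z U) ≡ cutSum G U (fromℤ ∘ z)
  fromℤ-outSum G z U = trans (fromℤ-sumℤ _ (allArcs G)) (trans (sumℚ-allArcs G _)
    (sum-cong-≗ (λ e → cong₂ _+_ (fromℤ-onCut (e , true)) (fromℤ-onCut (e , false)))))
    where
    fromℤ-onCut : ∀ a → fromℤ (if U (tail G a) then (if U (head G a) then + 0 else z a) else + 0)
                      ≡ onCut G U a (fromℤ (z a))
    fromℤ-onCut a = trans (if-float fromℤ (U (tail G a)))
      (cong (λ q → if U (tail G a) then q else 0ℚ) (if-float fromℤ (U (head G a))))

module Circulations where
  open FiniteSums
  open FromInteger
  open Halving
  open CutSums
  open import Defs
  open import Algebra.Bundles using (Ring)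
  import Data.Rational.Properties as ℚP
  open import Algebra.Properties.Semiring.Sum (Ring.semiring ℚP.+-*-ring)
    using (sum; sum-syntax; sum-cong-≗)
  open import Data.Bool using (Bool; true; false; not; _xor_; if_then_else_)
  open import Data.Bool.Properties using (not-distribʳ-xor)
  open import Data.Fin using (Fin)
  open import Data.Fin.Properties using (_≟_)
  open import Data.List using (allFin)
  open import Data.List.Properties using (map-cong)
  open import Data.Nat as ℕ using (ℕ; z≤n)
  open import Data.Product using (_×_; _,_; proj₁; proj₂)
  open import Data.Integer as ℤ using (ℤ; +_; ∣_∣; +≤+)
  import Data.Integer.Properties as ℤP
  open import Data.Rational using (ℚ; 0ℚ; 1ℚ; _/_; _+_; _-_; -_; _*_; _≤_)
  open import Data.Rational.Literals using (fromℤ)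
  open import Function using (_∘_)
  open import Relation.Nullary using (does)
  open import Relation.Binary.PropositionalEquality using (_≡_; refl; sym; trans; cong; module ≡-Reasoning)

  IsCirculation : (G : Graph) → (Fin (m G) → Bool) → (Fin (m G) → ℚ) → Set
  IsCirculation G o f = ∀ v → outFlow G o f v ≡ inFlow G o f v

  -- b xor o e holds exactly when the arc (e , b) runs against the orientation o.
  arcFlow : (G : Graph) → (Fin (m G) → Bool) → (Fin (m G) → ℚ) → Arc G → ℚ
  arcFlow G o f (e , b) = if b xor o e then - f e else f e

  splitAlong : (G : Graph) → (Fin (m G) → Bool) → (Arc G → ℤ) → Arc G → ℤ
  splitAlong G o w (e , b) = + half (b xor o e) ∣ w (e , b) ∣

  splitAlong-nonNeg : ∀ G o (w : Arc G → ℤ) a → + 0 ℤ.≤ splitAlong G o w a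
  splitAlong-nonNeg G o w (e , b) = +≤+ z≤n

  splitAlong-complement : ∀ G o (w : Arc G → ℤ) a → + 0 ℤ.≤ w a →
    splitAlong G o w a ℤ.+ splitAlong G (not ∘ o) w a ≡ w a
  splitAlong-complement G o w (e , b) w≥0 = begin
    + (half (b xor o e) ∣w∣ ℕ.+ half (b xor not (o e)) ∣w∣)
      ≡⟨ cong (λ d → + (half (b xor o e) ∣w∣ ℕ.+ half d ∣w∣)) (not-distribʳ-xor b (o e)) ⟨
    + (half (b xor o e) ∣w∣ ℕ.+ half (not (b xor o e)) ∣w∣)
      ≡⟨ cong +_ (half-complement (b xor o e) ∣w∣) ⟩
    + ∣w∣
      ≡⟨ ℤP.0≤i⇒+∣i∣≡i w≥0 ⟩
    w (e , b) ∎
    where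
    open ≡-Reasoning
    ∣w∣ : ℕ
    ∣w∣ = ∣ w (e , b) ∣

  crossing-balance : ∀ u v (x : ℚ) →
    exiting u v x + exiting v u (- x) ≡ (if u then x else 0ℚ) - (if v then x else 0ℚ)
  crossing-balance true  true  x = sym (ℚP.+-inverseʳ x)
  crossing-balance true  false x = refl
  crossing-balance false true  x = refl
  crossing-balance false false x = refl

  module Circulation (G : Graph) (o : Fin (m G) → Bool) (f : Fin (m G) → ℚ)
                     (circulation : IsCirculation G o f) where

    tailIn headIn : VSubset G → Fin (m G) → ℚ
    tailIn U e = if U (orientedTail G o e) then f e else 0ℚ
    headIn U e = if U (orientedHead G o e) then f e else 0ℚ

    tailIn≡headIn : ∀ U → sum (tailIn U) ≡ sum (headIn U)
    tailIn≡headIn U = begin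
      sum (tailIn U)                                      ≡⟨ ∑-fibres (orientedTail G o) f U ⟨
      ∑[ v < n G ] (if U v then outFlow G o f v else 0ℚ)  ≡⟨ sum-cong-≗ (λ v → cong (λ s → if U v then s else 0ℚ) (circulation v)) ⟩
      ∑[ v < n G ] (if U v then inFlow G o f v else 0ℚ)   ≡⟨ ∑-fibres (orientedHead G o) f U ⟩
      sum (headIn U)                                      ∎
      where open ≡-Reasoning

    edge-crossing : ∀ U e →
      onCut G U (e , true) (arcFlow G o f (e , true)) + onCut G U (e , false) (arcFlow G o f (e , false))
        ≡ tailIn U e - headIn U e
    edge-crossing U e with o e
    ... | true  = crossing-balance (U (proj₁ (ends G e))) (U (proj₂ (ends G e))) (f e)
    ... | false = trans (ℚP.+-comm (exiting (U (proj₁ (ends G e))) (U (proj₂ (ends G e))) (- f e)) _)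
                        (crossing-balance (U (proj₂ (ends G e))) (U (proj₁ (ends G e))) (f e))

    cutSum-arcFlow : ∀ U → cutSum G U (arcFlow G o f) ≡ 0ℚ
    cutSum-arcFlow U = begin
      cutSum G U (arcFlow G o f)              ≡⟨ sum-cong-≗ (edge-crossing U) ⟩
      ∑[ e < m G ] (tailIn U e - headIn U e)  ≡⟨ ∑-distrib-- (tailIn U) (headIn U) ⟩
      sum (tailIn U) - sum (headIn U)         ≡⟨ cong (_- sum (headIn U)) (tailIn≡headIn U) ⟩
      sum (headIn U) - sum (headIn U)         ≡⟨ ℚP.+-inverseʳ (sum (headIn U)) ⟩
      0ℚ                                      ∎
      where open ≡-Reasoning

    cut-bound : ∀ {k} → (∀ e → (1ℚ ≤ f e) × (f e ≤ k - 1ℚ)) → (w : Arc G → ℤ) → (∀ a → + 1 ℤ.≤ w a) →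
      ∀ U → fromℤ (outSum G w U) ≤ (k + 1ℚ) * fromℤ (outSum G (splitAlong G o w) U)
    cut-bound {k} f-bounds w w≥1 U = begin
      fromℤ (outSum G w U)                              ≡⟨ fromℤ-outSum G w U ⟩
      ∑ᵃ G W                                            ≡⟨ ℚP.+-identityʳ (∑ᵃ G W) ⟨
      ∑ᵃ G W + 0ℚ                                       ≡⟨ cong (_+_ (∑ᵃ G W)) (cutSum-arcFlow U) ⟨
      ∑ᵃ G W + ∑ᵃ G Φ                                   ≡⟨ ∑ᵃ-distrib-+ G W Φ ⟨
      ∑ᵃ G (λ a → W a + Φ a)                            ≤⟨ ∑ᵃ-mono-≤ G arc-bound ⟩
      ∑ᵃ G (λ a → (k + 1ℚ) * X a)                       ≡⟨ *-distribˡ-∑ᵃ G (k + 1ℚ) X ⟨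
      (k + 1ℚ) * ∑ᵃ G X                                 ≡⟨ cong (_*_ (k + 1ℚ)) (fromℤ-outSum G (splitAlong G o w) U) ⟨
      (k + 1ℚ) * fromℤ (outSum G (splitAlong G o w) U)  ∎
      where
      open ℚP.≤-Reasoning
      W Φ X : Arc G → ℚ
      W a = onCut G U a (fromℤ (w a))
      Φ a = onCut G U a (arcFlow G o f a)
      X a = onCut G U a (fromℤ (splitAlong G o w a))
      arc-bound : ∀ a → W a + Φ a ≤ (k + 1ℚ) * X a
      arc-bound a@(e , b) = exiting-+-≤ (U (tail G a)) (U (head G a)) (k + 1ℚ)
        (half-bound {k} (proj₁ (f-bounds e)) (proj₂ (f-bounds e)) (b xor o e) (w≥1 a))

  tail-not : ∀ G e b → tail G (e , not b) ≡ head G (e , b)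
  tail-not G e true  = refl
  tail-not G e false = refl

  head-not : ∀ G e b → head G (e , not b) ≡ tail G (e , b)
  head-not G e true  = refl
  head-not G e false = refl

  reverse-isCirculation : ∀ G o f → IsCirculation G o f → IsCirculation G (not ∘ o) f
  reverse-isCirculation G o f circulation v = begin
    outFlow G (not ∘ o) f v  ≡⟨ cong sumℚ (map-cong (λ e → cong (at-v e) (tail-not G e (o e))) (allFin (m G))) ⟩
    inFlow G o f v           ≡⟨ circulation v ⟨
    outFlow G o f v          ≡⟨ cong sumℚ (map-cong (λ e → cong (at-v e) (head-not G e (o e))) (allFin (m G))) ⟨
    inFlow G (not ∘ o) f v   ∎
    where
    open ≡-Reasoning
    at-v : Fin (m G) → Fin (n G) → ℚ
    at-v e t = if does (t ≟ v) then f e else 0ℚ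

  splitAlong-SCD : ∀ {G k τ} o f (w : Arc G → ℤ) → + 2 / 1 ≤ k →
    (∀ e → (1ℚ ≤ f e) × (f e ≤ k - 1ℚ)) → IsCirculation G o f →
    (∀ a → + 1 ℤ.≤ w a) → IsSCD G τ w → IsSCD G (floorDiv τ k) (splitAlong G o w)
  splitAlong-SCD {G} {k} o f w k≥2 f-bounds circulation w≥1 w-SCD U cut = floorDiv-≤ {k = k} (k+1>0 k≥2)
    (ℚP.≤-trans (fromℤ-mono-≤ (w-SCD U cut)) (Circulation.cut-bound G o f circulation {k} f-bounds w w≥1 U))

open Circulations
open import Defs
open import Data.Bool using (not)
open import Data.Nat using (z≤n)
open import Data.Product using (Σ; _×_; _,_)
open import Data.Integer using (ℤ; +_; _≤_; _+_; +≤+)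
open import Data.Integer.Properties using (≤-reflexive; ≤-trans)
open import Data.Rational using (ℚ; _/_) renaming (_≤_ to _≤ℚ_)
open import Function using (_∘_)

theorem12 : (G : Graph) (k : ℚ) → (+ 2 / 1) ≤ℚ k → HasNowhereZeroCircularFlow G k →
    (τ : ℤ) → + 1 ≤ τ → (w : Arc G → ℤ) → IsNowhereZeroSCD G τ w →
    Σ (Arc G → ℤ) λ x → Σ (Arc G → ℤ) λ y →
    (∀ a → + 0 ≤ x a) × (∀ a → + 0 ≤ y a) × (∀ a → x a + y a ≤ w a) ×
    IsSCD G (floorDiv τ k) x × IsSCD G (floorDiv τ k) y
theorem12 G k k≥2 (o , f , f-bounds , circulation) τ _ w (w≥1 , w-SCD) =
  splitAlong G o w , splitAlong G (not ∘ o) w ,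
  splitAlong-nonNeg G o w , splitAlong-nonNeg G (not ∘ o) w ,
  (λ a → ≤-reflexive (splitAlong-complement G o w a (≤-trans (+≤+ z≤n) (w≥1 a)))) ,
  splitAlong-SCD o f w k≥2 f-bounds circulation w≥1 w-SCD ,
  splitAlong-SCD (not ∘ o) f w k≥2 f-bounds (reverse-isCirculation G o f circulation) w≥1 w-SCD
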